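{- Let $k\ge r\ge3$, $m\geq 0$, and let $\pi\in\mathbb{C}_{<}(k,r|p,t)$ with $p,t\ge0$ and $p+t=m$. Then there do not exist nonnegative integers $p',t'$ with $p'\neq p$, $t'\neq t$, $p'+t'=m$ and $\pi\in\mathbb{C}_{<}(k,r|p',t')$.
   Context: A partition is a finite non-increasing sequence of positive integers. $\mathbb{C}(k,r)$ is the set of partitions $\pi=(\pi_1,\dots,\pi_\ell)$ with no repeated odd part, $\pi_i\ge\pi_{i+k-1}+2$ for $1\le i\le\ell-k+1$ (strict if $\pi_i$ even), and at most $r-1$ parts $\le2$. Göllnitz–Gordon marking $GG(\pi)$: marks (positive integers) are assigned to the parts from smallest to largest, each as small as possible subject to: the mark of $\pi_i$ differs from the marks of all parts $\pi_g$, $g>i$, with $\pi_i-\pi_g\le2$ (strict if $\pi_i$ odd). A "$j$-marked $x$" is a part $x$ with mark $j$. $N_j$ is the number of $j$-marked parts and $\pi^{(j)}_1>\cdots>\pi^{(j)}_{N_j}$ are these parts; $\pi^{(j)}_0=+\infty$, $\pi^{(j)}_{N_j+1}=-\infty$. Starting types (for $N_2\ge1$): let $l$ be the largest integer $0\le l\le N_2$ such that no odd part of $\pi$ is $\ge\pi^{(2)}_l$; parts $\pi^{(2)}_i$, $i>l$, are of type $s_{ -1}$. For $b=1$: $\pi^{(2)}_1$ is of type $s_0$ [resp. $s_1$] with $s_1(\pi)=\pi^{(2)}_1-1$ [resp. $-2$] if there is a 1-marked $\pi^{(2)}_1-1$ [resp. $\pi^{(2)}_1-2$] and $\pi^{(2)}_1+2$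 does not occur; of type $s_2$ ($s_1(\pi)=\pi^{(2)}_1+2$) if there is a 1-marked $\pi^{(2)}_1+2$; of type $s_3$ ($s_1(\pi)=\pi^{(2)}_1$) if there is a 1-marked $\pi^{(2)}_1$. For $b=2,\dots,l$: type $s_0$ [resp. $s_1$], $s_b(\pi)=\pi^{(2)}_b-1$ [resp. $-2$], if there is a 1-marked $\pi^{(2)}_b-1$ [resp. $-2$] and, whenever a 1-marked $\pi^{(2)}_b+2$ exists, $s_{b-1}(\pi)=\pi^{(2)}_b+2$; type $s_2$ ($s_b(\pi)=\pi^{(2)}_b+2$) if there is a 1-marked $\pi^{(2)}_b+2$ and $s_{b-1}(\pi)\neq\pi^{(2)}_b+2$; type $s_3$ ($s_b(\pi)=\pi^{(2)}_b$) if there is a 1-marked $\pi^{(2)}_b$. $\mathbb{C}_{<}(k,r|p,t)$ is the set of $\pi\in\mathbb{C}(k,r)$ such that: (1) no odd part is $\ge2t+1$; (2) $\pi^{(2)}_{p+1}<2t+1<\pi^{(2)}_p$; (3) if $\pi^{(2)}_p=2t+2$ it is of starting type $s_2$ or $s_3$; (4) if $\pi^{(2)}_{p+1}=2t$ it is of starting type $s_0$ or $s_1$. -}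

module Defs where

open import Data.Nat using (ℕ; zero; suc; _+_; _*_; _∸_; _≤_; _<_; _≤ᵇ_; _≡ᵇ_)
open import Data.Bool using (Bool; true; false; if_then_else_; not)
open import Data.List using (List; []; _∷_; length; filter; map; zip; lookup)
open import Data.List.Membership.Propositional using (_∈_; _∉_)
open import Data.List.Relation.Unary.All using (All)
open import Data.List.Relation.Unary.Linked using (Linked)
open import Data.Fin using (Fin; toℕ)
open import Data.Product using (Σ; _×_; _,_; proj₁; proj₂)
open import Data.Sum using (_⊎_)
open import Data.Empty using (⊥)
open import Data.Unit using (⊤)
open import Relation.Nullary using (¬_)
open import Relation.Binary.PropositionalEquality using (_≡_; _≢_)

even : ℕ → Bool
even zero = true
even (suc n) = not (even n)

Odd : ℕ → Set
Odd n = even n ≡ false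

Even : ℕ → Set
Even n = even n ≡ true

IsPartition : List ℕ → Set
IsPartition π = Linked (λ a b → b ≤ a) π × All (λ x → 1 ≤ x) π

-- The set ℂ(k,r)  (positions are 0-based Fin indices)

NoRepeatedOddPart : List ℕ → Set
NoRepeatedOddPart π = (i j : Fin (length π)) → i ≢ j →
  lookup π i ≡ lookup π j → ¬ Odd (lookup π i)

DiffCond : ℕ → List ℕ → Set
DiffCond k π = (i j : Fin (length π)) → toℕ j ≡ toℕ i + (k ∸ 1) →
  (Even (lookup π i) → lookup π j + 2 < lookup π i) ×
  (Odd (lookup π i) → lookup π j + 2 ≤ lookup π i)

InC : ℕ → ℕ → List ℕ → Set
InC k r π = IsPartition π × NoRepeatedOddPart π × DiffCond k π ×
  (length (filter (λ x → x Data.Nat.≤? 2) π) ≤ r ∸ 1)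

-- Marks are assigned from the smallest part (end of the list) to the
-- largest; the mark of π_i is the least positive integer different from
-- the marks of all π_g (g > i) with π_i - π_g ≤ 2 (< 2 if π_i odd).

-- is y (a later, hence not larger, part) in conflict with x?
near : ℕ → ℕ → Bool
near x y = if even x then x ≤ᵇ y + 2 else suc x ≤ᵇ y + 2

forbidden : ℕ → List ℕ → List ℕ → List ℕ
forbidden x [] _ = []
forbidden x (y ∷ ys) [] = []
forbidden x (y ∷ ys) (m ∷ ms) =
  if near x y then m ∷ forbidden x ys ms else forbidden x ys ms

member : ℕ → List ℕ → Bool
member n [] = false
member n (m ∷ ms) = if n ≡ᵇ m then true else member n ms

leastFrom : ℕ → ℕ → List ℕ → ℕ
leastFrom zero n l = n
leastFrom (suc f) n l = if member n l then leastFrom f (suc n) l else n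

mex : List ℕ → ℕ
mex l = leastFrom (suc (length l)) 1 l

marks : List ℕ → List ℕ
marks [] = []
marks (x ∷ xs) = mex (forbidden x xs (marks xs)) ∷ marks xs

Marked : ℕ → List ℕ → ℕ → Set
Marked j π y = (y , j) ∈ zip π (marks π)

twoMarked : List ℕ → List ℕ
twoMarked π = map proj₁ (filter (λ p → proj₂ p Data.Nat.≟ 2) (zip π (marks π)))

N₂ : List ℕ → ℕ
N₂ π = length (twoMarked π)

data Ext : Set where
  -∞ : Ext
  fin : ℕ → Ext
  +∞ : Ext

data _<ₑ_ : Ext → Ext → Set where
  -∞<fin : ∀ {n} → -∞ <ₑ fin n
  -∞<+∞ : -∞ <ₑ +∞
  fin<fin : ∀ {m n} → m < n → fin m <ₑ fin n
  fin<+∞ : ∀ {n} → fin n <ₑ +∞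

entryExt : List ℕ → ℕ → Ext
entryExt xs zero = +∞
entryExt [] (suc n) = -∞
entryExt (x ∷ xs) (suc zero) = fin x
entryExt (x ∷ xs) (suc (suc n)) = entryExt xs (suc n)

-- π^(2)_i  (with π^(2)_0 = +∞ and π^(2)_{N₂+1} = -∞)
π² : List ℕ → ℕ → Ext
π² π i = entryExt (twoMarked π) i

LAdm : List ℕ → ℕ → Set
LAdm π i = i ≤ N₂ π × ((y : ℕ) → y ∈ π → Odd y → fin y <ₑ π² π i)

IsL : List ℕ → ℕ → Set
IsL π l = LAdm π l × ((i : ℕ) → LAdm π i → i ≤ l)

data SType : Set where
  s0 s1 s2 s3 : SType

sValue : SType → ℕ → ℕ
sValue s0 x = x ∸ 1
sValue s1 x = x ∸ 2
sValue s2 x = x + 2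
sValue s3 x = x

mutual
  IsType : List ℕ → ℕ → SType → Set
  IsType π zero j = ⊥
  IsType π (suc n) j =
    Σ ℕ (λ l → IsL π l × suc n ≤ l) ×
    Σ ℕ (λ x → π² π (suc n) ≡ fin x × TypeCond π n x j)

  TypeCond : List ℕ → ℕ → ℕ → SType → Set
  TypeCond π n x s0 = Marked 1 π (x ∸ 1) × Guard π n x
  TypeCond π n x s1 = Marked 1 π (x ∸ 2) × Guard π n x
  TypeCond π n x s2 = Marked 1 π (x + 2) × NotPrev π n x
  TypeCond π n x s3 = Marked 1 π x

  -- b = 1 : x+2 does not occur;
  -- b ≥ 2 : whenever a 1-marked x+2 exists, s_{b-1}(π) = x+2
  Guard : List ℕ → ℕ → ℕ → Set
  Guard π zero x = (x + 2) ∉ π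
  Guard π (suc m) x = Marked 1 π (x + 2) → SEq π (suc m) (x + 2)

  -- b = 1 : no extra condition;  b ≥ 2 : s_{b-1}(π) ≠ x+2
  NotPrev : List ℕ → ℕ → ℕ → Set
  NotPrev π zero x = ⊤
  NotPrev π (suc m) x = ¬ SEq π (suc m) (x + 2)

  SEq : List ℕ → ℕ → ℕ → Set
  SEq π b v = Σ SType (λ j → IsType π b j ×
    Σ ℕ (λ x → π² π b ≡ fin x × v ≡ sValue j x))

CLess : ℕ → ℕ → ℕ → ℕ → List ℕ → Set
CLess k r p t π =
  InC k r π ×
  ((y : ℕ) → y ∈ π → Odd y → y < 2 * t + 1) ×
  (π² π (suc p) <ₑ fin (2 * t + 1) × fin (2 * t + 1) <ₑ π² π p) ×
  (π² π p ≡ fin (2 * t + 2) → IsType π p s2 ⊎ IsType π p s3) ×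
  (π² π (suc p) ≡ fin (2 * t) → IsType π (suc p) s0 ⊎ IsType π (suc p) s1)

{-# OPTIONS --safe #-}
-- The 2-marked parts of a Göllnitz–Gordon marking drop by at least 2 from one
-- to the next, and by at least 3 after an even one.  Suppose π lay in both
-- windows (p, t) and (p + d, t − d) with d ≥ 1.  The d − 1 gaps between
-- π⁽²⁾_{p+1} < 2t + 1 and π⁽²⁾_{p+d} > 2(t − d) + 1 then force π⁽²⁾_{p+1} = 2t.
-- For d ≥ 2 the extra 1 in the gap after this even part pushes it to 2t + 1.
-- For d = 1 the part 2t must be of starting type s₀ or s₁ and of type s₂ or s₃
-- at once: s₀ yields an odd part 2t − 1 above the second window, the guards of
-- s₁ and s₂ contradict each other, and s₁ with s₃ yields 1-marked parts 2t − 2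
-- and 2t, which are too close to carry the same mark.
module Submission where

open import Defs
open import Data.Nat using (ℕ; zero; suc; _+_; _*_; _∸_; _≤_; _<_; _≥_; _≤ᵇ_; _≡ᵇ_; z≤n; s≤s; z<s)
open import Data.Nat.Properties
open import Data.Nat.Tactic.RingSolver using (solve-∀)
open import Data.Bool using (true; false; not; T)
open import Data.Bool.Properties using (not-involutive)
open import Data.List using (List; []; _∷_; length; drop; zip)
open import Data.List.Membership.Propositional using (_∈_; _∉_)
open import Data.List.Membership.Propositional.Properties using (∈-map⁻; ∈-filter⁻)
open import Data.List.Relation.Unary.Any using (here; there)
open import Data.List.Relation.Unary.All as All using ()
open import Data.List.Relation.Unary.AllPairs using (_∷_)
open import Data.List.Relation.Unary.Linked as Linked using (Linked; []; [-]; _∷_)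
open import Data.List.Relation.Unary.Linked.Properties using (Linked⇒AllPairs)
open import Data.Product using (Σ; _×_; _,_; proj₁; proj₂)
open import Data.Sum using (inj₁; inj₂)
open import Data.Empty using (⊥; ⊥-elim)
open import Relation.Nullary using (¬_)
open import Relation.Binary.PropositionalEquality using (_≡_; _≢_; refl; sym; trans; cong; subst; module ≡-Reasoning)
open import Relation.Binary.Definitions using (tri<; tri≈; tri>)

2*[1+n]≡2+2*n : ∀ n → 2 * suc n ≡ suc (suc (2 * n))
2*[1+n]≡2+2*n = solve-∀

2*[1+n]≡2*n+2 : ∀ n → 2 * suc n ≡ 2 * n + 2
2*[1+n]≡2*n+2 = solve-∀

even-double : ∀ n → Even (2 * n)
even-double zero = refl
even-double (suc n) = begin
  even (2 * suc n)            ≡⟨ cong even (2*[1+n]≡2+2*n n) ⟩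
  not (not (even (2 * n)))    ≡⟨ not-involutive _ ⟩
  even (2 * n)                ≡⟨ even-double n ⟩
  true                        ∎
  where open ≡-Reasoning

odd-suc-double : ∀ n → Odd (suc (2 * n))
odd-suc-double n = cong not (even-double n)

fin<fin⁻¹ : ∀ {m n} → fin m <ₑ fin n → m < n
fin<fin⁻¹ (fin<fin m<n) = m<n

zip-∈ˡ : ∀ {A B : Set} {xs : List A} {ys : List B} {a b} → (a , b) ∈ zip xs ys → a ∈ xs
zip-∈ˡ {xs = _ ∷ _} {_ ∷ _} (here refl) = here refl
zip-∈ˡ {xs = _ ∷ _} {_ ∷ _} (there h) = there (zip-∈ˡ h)

member-∈ : ∀ {n l} → n ∈ l → T (member n l)
member-∈ {n} (here refl) with n ≡ᵇ n | ≡⇒≡ᵇ n n refl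
... | true | _ = _
member-∈ {n} {m ∷ _} (there n∈l) with n ≡ᵇ m
... | true = _
... | false = member-∈ n∈l

leastFrom-∉ : ∀ f n l → leastFrom f n l < n + f → leastFrom f n l ∉ l
leastFrom-∉ zero n l n<n+0 = ⊥-elim (<-irrefl (sym (+-identityʳ n)) n<n+0)
leastFrom-∉ (suc f) n l lt with member n l in eq
... | true = leastFrom-∉ f (suc n) l (subst (leastFrom f (suc n) l <_) (+-suc n f) lt)
... | false = λ n∈l → subst T eq (member-∈ n∈l)

-- Restricting to marks ≤ 2 avoids the pigeonhole argument showing that the
-- search for the mex never runs out of fuel.
mex-∉ : ∀ l → mex l ≤ 2 → mex l ∉ l
mex-∉ [] _ ()
mex-∉ l@(_ ∷ _) mex≤2 = leastFrom-∉ (suc (length l)) 1 l (s≤s (≤-trans mex≤2 (s≤s (s≤s z≤n))))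

Apart : ℕ → ℕ → Set
Apart x y = near x y ≡ false

≤ᵇ-false⇒> : ∀ {m n} → (m ≤ᵇ n) ≡ false → n < m
≤ᵇ-false⇒> eq = ≰⇒> (λ m≤n → subst T eq (≤⇒≤ᵇ m≤n))

apart⇒+2≤ : ∀ {x y} → Apart x y → y + 2 ≤ x
apart⇒+2≤ {x} eq with even x
... | true = <⇒≤ (≤ᵇ-false⇒> eq)
... | false = m<1+n⇒m≤n (≤ᵇ-false⇒> eq)

even-apart⇒+2< : ∀ {x y} → Even x → Apart x y → y + 2 < x
even-apart⇒+2< {x} ev eq with even x | ev
... | true | _ = ≤ᵇ-false⇒> eq

even-near : ∀ {x y} → Even x → x ≤ y + 2 → T (near x y)
even-near {x} ev x≤y+2 with even x | ev
... | true | _ = ≤⇒≤ᵇ x≤y+2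

forbidden-∈ : ∀ {x ys ms y j} → (y , j) ∈ zip ys ms → T (near x y) → j ∈ forbidden x ys ms
forbidden-∈ {x} {y ∷ _} {_ ∷ _} (here refl) near-xy with near x y | near-xy
... | true | _ = here refl
forbidden-∈ {x} {y′ ∷ _} {_ ∷ _} (there h) near-xy with near x y′
... | true = there (forbidden-∈ h near-xy)
... | false = forbidden-∈ h near-xy

-- mex (forbidden a as (marks as)) is the mark of the head a of a ∷ as.
marked-head-apart : ∀ a as {b j} → mex (forbidden a as (marks as)) ≡ j → j ≤ 2 →
  (b , j) ∈ zip as (marks as) → Apart a b
marked-head-apart a as {b} refl mex≤2 b∈ with near a b in eq
... | false = refl
... | true = ⊥-elim (mex-∉ _ mex≤2 (forbidden-∈ b∈ (subst T (sym eq) _)))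

sameMark-apart : ∀ {j π y z} → j ≤ 2 → Linked _≥_ π →
  Marked j π y → Marked j π z → z < y → Apart y z
sameMark-apart {π = a ∷ as} _ _ (here refl) (here refl) z<y = ⊥-elim (<-irrefl refl z<y)
sameMark-apart {π = a ∷ as} j≤2 _ (here refl) (there z∈) _ = marked-head-apart a as refl j≤2 z∈
sameMark-apart {π = a ∷ as} _ sorted (there y∈) (here refl) z<y
  with Linked⇒AllPairs (λ b≤a c≤b → ≤-trans c≤b b≤a) sorted
... | a≥as ∷ _ = ⊥-elim (<-irrefl refl (<-≤-trans z<y (All.lookup a≥as (zip-∈ˡ y∈))))
sameMark-apart {π = _ ∷ _} j≤2 sorted (there y∈) (there z∈) z<y =
  sameMark-apart j≤2 (Linked.tail sorted) y∈ z∈ z<y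

twoMarked⇒marked : ∀ {π b} → b ∈ twoMarked π → Marked 2 π b
twoMarked⇒marked {π} b∈ with ∈-map⁻ proj₁ b∈
... | _ , q∈ , refl with ∈-filter⁻ (λ q → proj₂ q ≟ 2) {xs = zip π (marks π)} q∈
... | q∈zip , refl = q∈zip

linked-∷ : ∀ {R : ℕ → ℕ → Set} {a xs} → (∀ {b} → b ∈ xs → R a b) → Linked R xs →
  Linked R (a ∷ xs)
linked-∷ {xs = []} _ _ = [-]
linked-∷ {xs = _ ∷ _} R-a Rxs = R-a (here refl) ∷ Rxs

twoMarked-apart : ∀ π → Linked Apart (twoMarked π)
twoMarked-apart [] = []
twoMarked-apart (a ∷ as) with mex (forbidden a as (marks as)) ≡ᵇ 2 in eq
... | false = twoMarked-apart as
... | true =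
  linked-∷ (λ b∈ → marked-head-apart a as mex≡2 ≤-refl (twoMarked⇒marked b∈)) (twoMarked-apart as)
  where
  mex≡2 : mex (forbidden a as (marks as)) ≡ 2
  mex≡2 = ≡ᵇ⇒≡ _ 2 (subst T (sym eq) _)

drop⁺ : ∀ {R : ℕ → ℕ → Set} i {xs} → Linked R xs → Linked R (drop i xs)
drop⁺ zero Rxs = Rxs
drop⁺ (suc i) {[]} _ = []
drop⁺ (suc i) {_ ∷ _} Rxs = drop⁺ i (Linked.tail Rxs)

entryExt-drop : ∀ n i xs → entryExt (drop i xs) (suc n) ≡ entryExt xs (suc (n + i))
entryExt-drop n zero xs rewrite +-identityʳ n = refl
entryExt-drop n (suc i) [] = refl
entryExt-drop n (suc i) (_ ∷ xs) rewrite +-suc n i = entryExt-drop n i xs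

entryExt-above : ∀ xs n {c} → fin c <ₑ entryExt xs (suc n) →
  Σ ℕ λ y → entryExt xs (suc n) ≡ fin y × c < y
entryExt-above [] n ()
entryExt-above (x ∷ _) zero (fin<fin c<x) = x , refl , c<x
entryExt-above (_ ∷ xs) (suc n) c< = entryExt-above xs n c<

+2*suc : ∀ y n → y + 2 * suc n ≡ y + 2 * n + 2
+2*suc = solve-∀

head-gap : ∀ {xs} n {y} → Linked Apart xs → entryExt xs (suc n) ≡ fin y →
  Σ ℕ λ x → entryExt xs 1 ≡ fin x × y + 2 * n ≤ x
head-gap {x ∷ _} zero _ refl = x , refl , ≤-reflexive (+-identityʳ x)
head-gap {x ∷ b ∷ _} (suc n) {y} (x-b ∷ Rxs) eq with head-gap n Rxs eq
... | _ , refl , y+2n≤b = x , refl , (begin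
  y + 2 * suc n   ≡⟨ +2*suc y n ⟩
  y + 2 * n + 2   ≤⟨ +-monoˡ-≤ 2 y+2n≤b ⟩
  b + 2           ≤⟨ apart⇒+2≤ x-b ⟩
  x               ∎)
  where open ≤-Reasoning

even-head-gap : ∀ {xs x} n {y} → Linked Apart xs → entryExt xs 1 ≡ fin x → Even x →
  entryExt xs (suc (suc n)) ≡ fin y → y + 2 * suc n < x
even-head-gap {x ∷ b ∷ _} n {y} (x-b ∷ Rxs) refl ev eq with head-gap n Rxs eq
... | _ , refl , y+2n≤b = begin-strict
  y + 2 * suc n   ≡⟨ +2*suc y n ⟩
  y + 2 * n + 2   ≤⟨ +-monoˡ-≤ 2 y+2n≤b ⟩
  b + 2           <⟨ even-apart⇒+2< ev x-b ⟩
  x               ∎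
  where open ≤-Reasoning

typeCond⇒marked : ∀ {π n x} j → TypeCond π n x j → Marked 1 π (sValue j x)
typeCond⇒marked s0 (marked , _) = marked
typeCond⇒marked s1 (marked , _) = marked
typeCond⇒marked s2 (marked , _) = marked
typeCond⇒marked s3 marked = marked

isType⇒marked : ∀ {π b x} j → IsType π b j → π² π b ≡ fin x → Marked 1 π (sValue j x)
isType⇒marked {b = suc _} j (_ , _ , eq′ , cond) eq with refl ← trans (sym eq) eq′ =
  typeCond⇒marked j cond

¬s1∧s2 : ∀ {π b} → IsType π b s1 → IsType π b s2 → ⊥
¬s1∧s2 {π} {suc n} (_ , x , eq , _ , guard) (_ , _ , eq′ , marked , notPrev)
  with refl ← trans (sym eq) eq′ = guard-contradicts n guard notPrev
  where
  guard-contradicts : ∀ n → Guard π n x → NotPrev π n x → ⊥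
  guard-contradicts zero x+2∉π _ = x+2∉π (zip-∈ˡ marked)
  guard-contradicts (suc _) guard notPrev = notPrev (guard marked)

¬s1∧s3 : ∀ {π b x} → Linked _≥_ π → IsType π b s1 → IsType π b s3 →
  π² π b ≡ fin x → Even x → 2 ≤ x → ⊥
¬s1∧s3 {x = x} sorted t1 t3 eq ev 2≤x = subst T apart (even-near ev x≤x∸2+2)
  where
  x≤x∸2+2 : x ≤ x ∸ 2 + 2
  x≤x∸2+2 = ≤-reflexive (sym (m∸n+n≡m 2≤x))
  apart : Apart x (x ∸ 2)
  apart = sameMark-apart (s≤s z≤n) sorted (isType⇒marked s3 t3 eq) (isType⇒marked s1 t1 eq)
    (∸-monoʳ-< {n = 2} {o = 0} z<s 2≤x)

window-lower : ∀ n {t y} → 2 * t + 1 < y → 2 * suc (n + t) ≤ y + 2 * n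
window-lower n {t} {y} 2t+1<y = begin
  2 * suc (n + t)          ≡⟨ regroup n t ⟩
  suc (2 * t + 1) + 2 * n  ≤⟨ +-monoˡ-≤ (2 * n) 2t+1<y ⟩
  y + 2 * n                ∎
  where
  open ≤-Reasoning
  regroup : ∀ n t → 2 * suc (n + t) ≡ suc (2 * t + 1) + 2 * n
  regroup = solve-∀

window-squeeze : ∀ n {t x y} → 2 * t + 1 < y → y + 2 * n ≤ x → x < 2 * suc (n + t) + 1 →
  x ≡ 2 * suc (n + t)
window-squeeze n {t} {x} 2t+1<y y+2n≤x x<2t′+1 = ≤-antisym
  (m<1+n⇒m≤n (subst (x <_) (+-comm _ 1) x<2t′+1))
  (≤-trans (window-lower n 2t+1<y) y+2n≤x)

adjacent-windows-disjoint : ∀ {k r p t π} → CLess k r p (suc t) π → CLess k r (suc p) t π → ⊥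
adjacent-windows-disjoint {p = p} {t} {π}
  (((sorted , _) , _) , _ , (below , _) , _ , low-type)
  (_ , odd-parts′ , (_ , above′) , high-type′ , _)
  with entryExt-above (twoMarked π) p above′
... | x , eq , 2t+1<x
  with window-squeeze 0 2t+1<x (≤-reflexive (+-identityʳ x)) (fin<fin⁻¹ (subst (_<ₑ _) eq below))
... | refl with low-type eq | high-type′ (trans eq (cong fin (2*[1+n]≡2*n+2 t)))
... | inj₁ t0 | _ =
  <-irrefl (sym (+-comm (2 * t) 1)) (odd-parts′ _ (zip-∈ˡ odd-part) (odd-suc-double t))
  where
  odd-part : Marked 1 π (suc (2 * t))
  odd-part = subst (Marked 1 π) (cong (_∸ 1) (2*[1+n]≡2+2*n t)) (isType⇒marked s0 t0 eq)
... | inj₂ t1 | inj₁ t2 = ¬s1∧s2 t1 t2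
... | inj₂ t1 | inj₂ t3 = ¬s1∧s3 sorted t1 t3 eq (even-double (suc t))
  (subst (2 ≤_) (sym (2*[1+n]≡2+2*n t)) (s≤s (s≤s z≤n)))

¬slow-apart-descent : ∀ {xs} o {t} → Linked Apart xs →
  entryExt xs 1 <ₑ fin (2 * suc (suc o + t) + 1) → fin (2 * t + 1) <ₑ entryExt xs (suc (suc o)) → ⊥
¬slow-apart-descent {xs} o {t} apart below above with entryExt-above xs (suc o) above
... | y , eq-y , 2t+1<y with head-gap (suc o) apart eq-y
... | x , eq-x , y+2o≤x
  with refl ← window-squeeze (suc o) 2t+1<y y+2o≤x (fin<fin⁻¹ (subst (_<ₑ _) eq-x below))
  = <-irrefl refl (<-≤-trans
      (even-head-gap o apart eq-x (even-double (suc (suc o + t))) eq-y)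
      (window-lower (suc o) 2t+1<y))

distant-windows-disjoint : ∀ {k r p t π} o →
  CLess k r p (suc (suc o + t)) π → CLess k r (suc (suc o) + p) t π → ⊥
distant-windows-disjoint {p = p} {π = π} o (_ , _ , (below , _) , _) (_ , _ , (_ , above′) , _) =
  ¬slow-apart-descent o (drop⁺ p (twoMarked-apart π))
    (subst (_<ₑ _) (sym (entryExt-drop 0 p _)) below)
    (subst (_ <ₑ_) (sym (entryExt-drop (suc o) p _)) above′)

shift-decomposition : ∀ {p t p′ t′} → p < p′ → p + t ≡ p′ + t′ →
  Σ ℕ λ o → p′ ≡ suc o + p × t ≡ suc (o + t′)
shift-decomposition {p} {t} {p′} {t′} p<p′ eq = o , p′≡ , +-cancelˡ-≡ p t (suc (o + t′)) (begin
  p + t             ≡⟨ eq ⟩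
  p′ + t′           ≡⟨ cong (_+ t′) p′≡ ⟩
  suc o + p + t′    ≡⟨ regroup o p t′ ⟩
  p + suc (o + t′)  ∎)
  where
  open ≡-Reasoning
  o : ℕ
  o = p′ ∸ suc p
  p′≡ : p′ ≡ suc o + p
  p′≡ = sym (trans (sym (+-suc o p)) (m∸n+n≡m p<p′))
  regroup : ∀ o p t′ → suc o + p + t′ ≡ p + suc (o + t′)
  regroup = solve-∀

windows-disjoint : ∀ {k r p t p′ t′ π} → p < p′ → p + t ≡ p′ + t′ →
  CLess k r p t π → CLess k r p′ t′ π → ⊥
windows-disjoint {k} {r} p<p′ eq C C′ with shift-decomposition p<p′ eq
... | zero , refl , refl = adjacent-windows-disjoint {k} {r} C C′
... | suc o , refl , refl = distant-windows-disjoint {k} {r} o C C′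

proposition5p2 : (k r m p t : ℕ) (π : List ℕ) → 3 ≤ r → r ≤ k →
    p + t ≡ m → CLess k r p t π →
    ¬ (Σ ℕ (λ p′ → Σ ℕ (λ t′ → p′ ≢ p × t′ ≢ t × p′ + t′ ≡ m × CLess k r p′ t′ π)))
proposition5p2 k r m p t π _ _ p+t≡m C (p′ , t′ , p′≢p , _ , p′+t′≡m , C′) with <-cmp p p′
... | tri< p<p′ _ _ = windows-disjoint {k} {r} p<p′ (trans p+t≡m (sym p′+t′≡m)) C C′
... | tri≈ _ p≡p′ _ = p′≢p (sym p≡p′)
... | tri> _ _ p′<p = windows-disjoint {k} {r} p′<p (trans p′+t′≡m (sym p+t≡m)) C′ C
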